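{- Let $d\ge3$ and let $A=\lambda B+(1-\lambda)B'$ with $0<\lambda<1$, where $B$ and $B'$ are $d$-dimensional matrices of order $4$ equivalent to $\mathcal{M}_4^d$. Suppose the tessellation index of $A$ equals $d-1$ and that no new entry is added to the support of the filled subcubes of $B$ and $B'$, i.e. $\operatorname{supp}(B')\cap C\subseteq\operatorname{supp}(B)$ for every filled subcube $C$ of $B$ and $\operatorname{supp}(B)\cap C'\subseteq\operatorname{supp}(B')$ for every filled subcube $C'$ of $B'$. Then $A$ is equivalent to a matrix from $\mathcal{L}_4^d$.
   Context: Matrices are arrays indexed by $\{0,1,2,3\}^d$; $\operatorname{supp}(M)=\{\alpha:m_\alpha\ne0\}$. Two matrices are equivalent if one is obtained from the other by permuting coordinate positions and applying permutations of $\{0,1,2,3\}$ to individual coordinates. $\mathcal{M}_4^d$: entry $1$ iff $\sum\alpha_i\equiv0\pmod4$. $\mathcal{L}_4^d$ is the family of matrices $\lambda\mathcal{M}_4^d+(1-\lambda)M$, $0<\lambda<1$, where $M$ has entry $1$ iff $\alpha_1+\dots+\alpha_{d-1}+\pi(\alpha_d)\equiv0\pmod4$, $\pi=(0\,1)$, and $0$ otherwise. Define $p_1$: $0,1\mapsto0$, $2,3\mapsto1$; $p_2$: $0,2\mapsto0$, $1,3\mapsto1$; $p_3$: $0,3\mapsto0$, $1,2\mapsto1$; $\mu_1$: $0,2\mapsto0$, $1,3\mapsto1$; $\mu_2$: $0,1\mapsto0$, $2,3\mapsto1$; $\mu_3$: $0,2\mapsto0$, $1,3\mapsto1$; $Q_s^d=\{y\in\{0,1\}^d:\sum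 y_i\equiv s\pmod2\}$. A $(0,1)$-matrix $M$ is a block permutation with parameters $(\mathcal{E},\lambda,s)$ ($\mathcal{E}\in\{1,2,3\}^d$, $s\in\{0,1\}$, $\lambda:Q_s^d\to\{0,1\}$) if $m_\alpha=1$ exactly when $\bigoplus_i p_{\varepsilon_i}(\alpha_i)=s$ and $\bigoplus_i\mu_{\varepsilon_i}(\alpha_i)\oplus\lambda(p_{\varepsilon_1}(\alpha_1),\dots,p_{\varepsilon_d}(\alpha_d))=0$; its filled subcubes are $\{\alpha:p_{\varepsilon_i}(\alpha_i)=y_i\ \forall i\}$ for $y\in Q_s^d$. For $d\ge3$ every matrix equivalent to $\mathcal{M}_4^d$ is a block permutation with unique parameters; filled subcubes are taken with respect to these. The tessellation index of $A$ is the maximum dimension of a nonempty intersection of a filled subcube of $B$ with one of $B'$ (such intersections are products $T_1\times\dots\times T_d$ with $k$ factors of size $2$ and the rest of size $1$, having dimension $k$), or $-\infty$ if none intersect.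
   Formalization: The weight λ in $A=\lambda B+(1-\lambda)B'$ is rational, and the weight of the matrices in $\mathcal{L}_4^d$ is likewise taken in the rationals. -}

module Defs where

open import Data.Nat using (ℕ; zero; suc; _∸_; _%_; _≤_)
open import Data.Nat as ℕ using ()
open import Data.Fin using (Fin; zero; suc; toℕ)
open import Data.Fin.Permutation using (Permutation′; _⟨$⟩ʳ_)
open import Data.Bool using (Bool; true; false; if_then_else_; _∧_; _xor_; not)
open import Data.Product using (Σ; ∃; ∃-syntax; _×_; _,_)
open import Data.Rational using (ℚ; 0ℚ; 1ℚ; _+_; _*_; _-_; _<_)
open import Relation.Binary.PropositionalEquality using (_≡_; _≢_)
open import Relation.Nullary.Decidable using (⌊_⌋)

Index : ℕ → Set
Index d = Fin d → Fin 4

Matrix : ℕ → Set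
Matrix d = Index d → ℚ

act : {d : ℕ} → Permutation′ d → (Fin d → Permutation′ 4) → Index d → Index d
act σ τ α i = τ i ⟨$⟩ʳ α (σ ⟨$⟩ʳ i)

Equivalent : {d : ℕ} → Matrix d → Matrix d → Set
Equivalent {d} M N = Σ (Permutation′ d) λ σ → Σ (Fin d → Permutation′ 4) λ τ →
  ∀ (α : Index d) → N α ≡ M (act σ τ α)

coordSum : {d : ℕ} → Index d → ℕ
coordSum {zero} α = 0
coordSum {suc d} α = toℕ (α zero) ℕ.+ coordSum {d} (λ i → α (suc i))

indicator : Bool → ℚ
indicator b = if b then 1ℚ else 0ℚ

M4 : (d : ℕ) → Matrix d
M4 d α = indicator ⌊ coordSum α % 4 ℕ.≟ 0 ⌋

swap01 : Fin 4 → Fin 4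
swap01 zero = suc zero
swap01 (suc zero) = zero
swap01 x = x

piLast : (d : ℕ) → Index d → Index d
piLast d α i = if ⌊ toℕ i ℕ.≟ d ∸ 1 ⌋ then swap01 (α i) else α i

Mπ : (d : ℕ) → Matrix d
Mπ d α = M4 d (piLast d α)

InL4 : (d : ℕ) → Matrix d → Set
InL4 d N = Σ ℚ λ μ → (0ℚ < μ) × (μ < 1ℚ) ×
  (∀ α → N α ≡ μ * M4 d α + (1ℚ - μ) * Mπ d α)

-- p_1, p_2, p_3 and μ_1, μ_2, μ_3 (encoded by ε ∈ Fin 3: zero ↦ 1, suc zero ↦ 2, suc (suc zero) ↦ 3)
pmap : Fin 3 → Fin 4 → Bool
pmap zero a = ⌊ 2 ℕ.≤? toℕ a ⌋
pmap (suc zero) a = ⌊ toℕ a % 2 ℕ.≟ 1 ⌋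
pmap (suc (suc zero)) a = ⌊ toℕ a ℕ.≟ 1 ⌋ Data.Bool.∨ ⌊ toℕ a ℕ.≟ 2 ⌋

mumap : Fin 3 → Fin 4 → Bool
mumap zero a = ⌊ toℕ a % 2 ℕ.≟ 1 ⌋
mumap (suc zero) a = ⌊ 2 ℕ.≤? toℕ a ⌋
mumap (suc (suc zero)) a = ⌊ toℕ a % 2 ℕ.≟ 1 ⌋

xorAll : {d : ℕ} → (Fin d → Bool) → Bool
xorAll {zero} y = false
xorAll {suc d} y = y zero xor xorAll {d} (λ i → y (suc i))

InQ : {d : ℕ} → Bool → (Fin d → Bool) → Set
InQ s y = xorAll y ≡ s

record BPParams (d : ℕ) : Set where
  constructor bpParams
  field
    eps : Fin d → Fin 3
    lam : (Fin d → Bool) → Bool   -- only its values on Q_s^d matter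
    s   : Bool
open BPParams public

pvec : {d : ℕ} → BPParams d → Index d → (Fin d → Bool)
pvec P α i = pmap (eps P i) (α i)

muvec : {d : ℕ} → BPParams d → Index d → (Fin d → Bool)
muvec P α i = mumap (eps P i) (α i)

bpEntry : {d : ℕ} → BPParams d → Index d → Bool
bpEntry P α = ⌊ xorAll (pvec P α) Data.Bool.≟ s P ⌋ ∧
              not (xorAll (muvec P α) xor lam P (pvec P α))

IsBlockPerm : {d : ℕ} → Matrix d → BPParams d → Set
IsBlockPerm M P = ∀ α → M α ≡ indicator (bpEntry P α)

InSubcube : {d : ℕ} → BPParams d → (Fin d → Bool) → Index d → Set
InSubcube P y α = ∀ i → pmap (eps P i) (α i) ≡ y i

count4 : (Fin 4 → Bool) → ℕ
count4 f = c (f zero) ℕ.+ c (f (suc zero)) ℕ.+ c (f (suc (suc zero))) ℕ.+ c (f (suc (suc (suc zero))))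
  where c : Bool → ℕ
        c true = 1
        c false = 0

countFin : {d : ℕ} → (Fin d → Bool) → ℕ
countFin {zero} f = 0
countFin {suc d} f = (if f zero then 1 else 0) ℕ.+ countFin {d} (λ i → f (suc i))

-- The intersection of subcube y (params P) and subcube y' (params P') is the product
-- of the sets T_i = {a : p_{ε_i}(a) = y_i, p_{ε'_i}(a) = y'_i}; its dimension is the number of
-- factors of size 2.
factorSize : {d : ℕ} → BPParams d → (Fin d → Bool) → BPParams d → (Fin d → Bool) → Fin d → ℕ
factorSize P y P' y' i = count4 (λ a → ⌊ pmap (eps P i) a Data.Bool.≟ y i ⌋ ∧ ⌊ pmap (eps P' i) a Data.Bool.≟ y' i ⌋)

intersectionDim : {d : ℕ} → BPParams d → (Fin d → Bool) → BPParams d → (Fin d → Bool) → ℕ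
intersectionDim P y P' y' = countFin (λ i → ⌊ factorSize P y P' y' i ℕ.≟ 2 ⌋)

Intersect : {d : ℕ} → BPParams d → (Fin d → Bool) → BPParams d → (Fin d → Bool) → Set
Intersect P y P' y' = ∃[ α ] (InSubcube P y α × InSubcube P' y' α)

TessIndexEq : {d : ℕ} → BPParams d → BPParams d → ℕ → Set
TessIndexEq {d} P P' k =
  (∃[ y ] ∃[ y' ] (InQ (s P) y × InQ (s P') y' × Intersect P y P' y' × intersectionDim P y P' y' ≡ k)) ×
  (∀ y y' → InQ (s P) y → InQ (s P') y' → Intersect P y P' y' → intersectionDim P y P' y' ≤ k)

NoNewEntries : {d : ℕ} → Matrix d → BPParams d → Matrix d → Set
NoNewEntries M P N = ∀ y → InQ (s P) y → ∀ α → InSubcube P y α → N α ≢ 0ℚ → M α ≢ 0ℚ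

combo : {d : ℕ} → ℚ → Matrix d → Matrix d → Matrix d
combo l B B' α = l * B α + (1ℚ - l) * B' α

{-# OPTIONS --safe #-}

-- A matrix equivalent to 𝓜₄ᵈ is the indicator of the zero set of a form α ↦ Σₖ fₖ(αₖ)
-- over ℤ₄ whose components fₖ are bijections, so every line in direction k meets its
-- support exactly once.  Tessellation index d − 1 means that the block-permutation
-- parameters of B and B' differ in a single direction j.  On every j-line, the parity
-- constraint of block permutations and the no-new-entries hypotheses force the entry of B'
-- to be the image of the entry of B under the transposition π of the two symbols x with
-- p_{εⱼ}(x) ⊕ p_{ε'ⱼ}(x) ≠ s ⊕ s'; hence B'(α) = B(α with αⱼ replaced by π αⱼ).
-- Since d ≥ 3, moving inside supp B along two directions at once shows that symbols whose
-- fⱼ-values differ by 2 lie in the same p_{εⱼ}-block, whereas the two symbols swapped by π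
-- do not, so their fⱼ-values are adjacent in ℤ₄.  Moving direction j to the last position
-- and translating fⱼ so that these values become 0 and 1 turns B into 𝓜₄ᵈ and B' into
-- its twist by (0 1).

module Submission where

open import Defs
open import Data.Nat as ℕ using (ℕ; zero; suc; s≤s; _≤_; _∸_; _+_)
open import Data.Nat.Properties using (m≤n⇒m≤1+n; suc-injective; 1+n≰n)
open import Data.Nat.DivMod using (_mod_; _%_; %-distribˡ-+; m<n⇒m%n≡m)
open import Data.Rational as ℚ using (ℚ; 0ℚ; 1ℚ; _<_)
open import Data.Fin as F using (Fin; zero; suc; toℕ)
open import Data.Fin.Patterns using (0F; 1F; 2F; 3F)
open import Data.Fin.Permutation using (Permutation′; _⟨$⟩ʳ_; _⟨$⟩ˡ_; inverseˡ; inverseʳ; permutation; transpose; _∘ₚ_)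
import Data.Fin.Permutation.Components as PC
open import Data.Fin.Properties
  using (all?; toℕ<n; toℕ-fromℕ<; toℕ-fromℕ; toℕ-injective; punchInᵢ≢i; punchIn-injective)
open import Data.Bool as Bool using (Bool; true; false; _xor_; _∧_; if_then_else_)
open import Data.Bool.Properties using (xor-∧-commutativeRing; xor-comm; xor-assoc; xor-same)
open import Data.Product using (Σ; _×_; _,_; proj₁; proj₂)
open import Data.Sum as Sum using (_⊎_; inj₁; inj₂)
open import Data.Vec.Functional using (Vector; updateAt)
open import Data.Vec.Functional.Properties using (updateAt-id-local; updateAt-minimal; updateAt-updates)
open import Function using (_∘_; _∘₂_; const; flip)
open import Function.Bundles using (Injection)
open import Function.Properties.Inverse using (Inverse⇒Injection)
open import Level using (0ℓ)
open import Algebra.Bundles using (AbelianGroup; CommutativeRing)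
import Algebra.Properties.CommutativeMonoid.Sum
import Algebra.Properties.Group
open import Relation.Binary.PropositionalEquality
  using (_≡_; _≢_; refl; sym; trans; cong; cong₂; subst; subst₂; _≗_; module ≡-Reasoning)
open import Relation.Binary.PropositionalEquality.Algebra using (isMagma)
open import Relation.Nullary.Decidable
  using (Dec; yes; no; True; toWitness; from-yes; ⌊_⌋; ¬?; _→-dec_; _⊎-dec_; dec-true; dec-false)
open import Relation.Nullary.Negation using (¬_; contradiction)

-- ℤ₄ and sums over abelian groups

infixl 6 _+₄_
infix 8 -₄_

_+₄_ : Fin 4 → Fin 4 → Fin 4
a +₄ b = (toℕ a ℕ.+ toℕ b) mod 4

-₄_ : Fin 4 → Fin 4
-₄ a = (4 ∸ toℕ a) mod 4

ℤ₄ : AbelianGroup 0ℓ 0ℓ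
ℤ₄ = record
  { _≈_ = _≡_
  ; _∙_ = _+₄_
  ; ε = 0F
  ; _⁻¹ = -₄_
  ; isAbelianGroup = record
    { isGroup = record
      { isMonoid = record
        { isSemigroup = record
          { isMagma = isMagma _+₄_
          ; assoc = from-yes (all? λ x → all? λ y → all? λ z → (x +₄ y) +₄ z F.≟ x +₄ (y +₄ z))
          }
        ; identity = from-yes (all? λ x → 0F +₄ x F.≟ x) , from-yes (all? λ x → x +₄ 0F F.≟ x)
        }
      ; inverse = from-yes (all? λ x → -₄ x +₄ x F.≟ 0F) , from-yes (all? λ x → x +₄ -₄ x F.≟ 0F)
      ; ⁻¹-cong = cong -₄_
      }
    ; comm = from-yes (all? λ x → all? λ y → x +₄ y F.≟ y +₄ x)
    }
  }

xor-abelianGroup : AbelianGroup 0ℓ 0ℓ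
xor-abelianGroup = CommutativeRing.+-abelianGroup xor-∧-commutativeRing

infixl 9 _[_]≔_

_[_]≔_ : ∀ {a} {A : Set a} {n} → Vector A n → Fin n → A → Vector A n
α [ k ]≔ x = updateAt α k (const x)

module UpdateSums {c ℓ} (G : AbelianGroup c ℓ) where

  open AbelianGroup G
    using (Carrier; _≈_; _∙_; _⁻¹; _-_; ∙-congˡ; ∙-congʳ; assoc; setoid; commutativeMonoid)
    renaming (refl to ≈-refl)
  open import Algebra.Properties.AbelianGroup G using (xyx⁻¹≈y)
  open import Algebra.Properties.CommutativeMonoid.Sum commutativeMonoid using (sum)
  open import Algebra.Solver.CommutativeMonoid commutativeMonoid using (solve; _⊕_; _⊜_)
  open import Relation.Binary.Reasoning.Setoid setoid

  sum-updateAt : ∀ {a} {A : Set a} {n} (g : Fin n → A → Carrier) (α : Vector A n) k x →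
                 sum (λ i → g i ((α [ k ]≔ x) i)) ≈ sum (λ i → g i (α i)) ∙ (g k x - g k (α k))
  sum-updateAt g α zero x = begin
    y ∙ S                 ≈⟨ xyx⁻¹≈y a (y ∙ S) ⟨
    a ∙ (y ∙ S) ∙ a ⁻¹    ≈⟨ solve 4 (λ a y S a′ → (a ⊕ (y ⊕ S)) ⊕ a′ ⊜ (a ⊕ S) ⊕ (y ⊕ a′))
                                     ≈-refl a y S (a ⁻¹) ⟩
    a ∙ S ∙ (y - a)       ∎
    where
    a = g zero (α zero)
    y = g zero x
    S = sum (λ i → g (suc i) (α (suc i)))
  sum-updateAt g α (suc k) x = begin
    a ∙ S′        ≈⟨ ∙-congˡ (sum-updateAt (g ∘ suc) (α ∘ suc) k x) ⟩
    a ∙ (S ∙ δ)   ≈⟨ assoc a S δ ⟨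
    a ∙ S ∙ δ     ∎
    where
    a = g zero (α zero)
    S = sum (λ i → g (suc i) (α (suc i)))
    S′ = sum (λ i → g (suc i) (((α ∘ suc) [ k ]≔ x) i))
    δ = g (suc k) x - g (suc k) (α (suc k))

  sum-updateAt₂ : ∀ {a} {A : Set a} {n} (g : Fin n → A → Carrier) (α : Vector A n) {j k} → j ≢ k → ∀ x y →
                  sum (λ i → g i ((α [ j ]≔ x [ k ]≔ y) i)) ≈
                  sum (λ i → g i (α i)) ∙ ((g j x - g j (α j)) ∙ (g k y - g k (α k)))
  sum-updateAt₂ g α {j} {k} j≢k x y = begin
    sum (λ i → g i ((α [ j ]≔ x [ k ]≔ y) i))
      ≈⟨ sum-updateAt g (α [ j ]≔ x) k y ⟩
    sum (λ i → g i ((α [ j ]≔ x) i)) ∙ (g k y - g k ((α [ j ]≔ x) k))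
      ≡⟨ cong (λ z → _ ∙ (g k y - g k z)) (updateAt-minimal k j α (j≢k ∘ sym)) ⟩
    sum (λ i → g i ((α [ j ]≔ x) i)) ∙ (g k y - g k (α k))
      ≈⟨ ∙-congʳ (sum-updateAt g α j x) ⟩
    sum (λ i → g i (α i)) ∙ (g j x - g j (α j)) ∙ (g k y - g k (α k))
      ≈⟨ assoc _ _ _ ⟩
    sum (λ i → g i (α i)) ∙ ((g j x - g j (α j)) ∙ (g k y - g k (α k))) ∎

open UpdateSums using (sum-updateAt; sum-updateAt₂)
module ℤ₄Sum = Algebra.Properties.CommutativeMonoid.Sum (AbelianGroup.commutativeMonoid ℤ₄)
open ℤ₄Sum using () renaming (sum to ∑)

coordSum-mod-4 : ∀ {d} (α : Index d) → coordSum α % 4 ≡ toℕ (∑ α)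
coordSum-mod-4 {zero} α = refl
coordSum-mod-4 {suc d} α = begin
  (toℕ (α 0F) ℕ.+ coordSum (α ∘ suc)) % 4              ≡⟨ %-distribˡ-+ (toℕ (α 0F)) (coordSum (α ∘ suc)) 4 ⟩
  (toℕ (α 0F) % 4 ℕ.+ coordSum (α ∘ suc) % 4) % 4      ≡⟨ cong₂ (λ a b → (a ℕ.+ b) % 4) (m<n⇒m%n≡m (toℕ<n (α 0F)))
                                                                                      (coordSum-mod-4 (α ∘ suc)) ⟩
  (toℕ (α 0F) ℕ.+ toℕ (∑ (α ∘ suc))) % 4               ≡⟨ toℕ-fromℕ< _ ⟨
  toℕ (α 0F +₄ ∑ (α ∘ suc))                            ∎
  where open ≡-Reasoning

-- Tests toℕ x, as the definition of M4 does, so that M4≡zeroIndicator∘∑ is a single congruence.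
zeroIndicator : Fin 4 → ℚ
zeroIndicator x = indicator ⌊ toℕ x ℕ.≟ 0 ⌋

M4≡zeroIndicator∘∑ : ∀ d (α : Index d) → M4 d α ≡ zeroIndicator (∑ α)
M4≡zeroIndicator∘∑ d α = cong (λ r → indicator ⌊ r ℕ.≟ 0 ⌋) (coordSum-mod-4 α)

M4-cong : ∀ {d} {γ γ' : Index d} → γ ≗ γ' → M4 d γ ≡ M4 d γ'
M4-cong {d} {γ} {γ'} γ≗γ' = begin
  M4 d γ                  ≡⟨ M4≡zeroIndicator∘∑ d γ ⟩
  zeroIndicator (∑ γ)     ≡⟨ cong zeroIndicator (ℤ₄Sum.sum-cong-≗ γ≗γ') ⟩
  zeroIndicator (∑ γ')    ≡⟨ M4≡zeroIndicator∘∑ d γ' ⟨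
  M4 d γ'                 ∎
  where open ≡-Reasoning

zeroIndicator≢0 : ∀ {x} → zeroIndicator x ≢ 0ℚ → x ≡ 0F
zeroIndicator≢0 {0F}    _  = refl
zeroIndicator≢0 {suc _} ≢0 = contradiction refl ≢0

zeroIndicator-0F≢0 : zeroIndicator 0F ≢ 0ℚ
zeroIndicator-0F≢0 ()

zeroIndicator-cong : ∀ {x y} → (x ≡ 0F → y ≡ 0F) → (y ≡ 0F → x ≡ 0F) → zeroIndicator x ≡ zeroIndicator y
zeroIndicator-cong {0F}    {_}     x⇒y _ rewrite x⇒y refl = refl
zeroIndicator-cong {suc _} {0F}    _ y⇒x = contradiction (y⇒x refl) λ ()
zeroIndicator-cong {suc _} {suc _} _ _   = refl

-- Matrices equivalent to 𝓜₄ as zero sets of forms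

Form : ℕ → Set
Form d = Fin d → Permutation′ 4

⟦_⟧ : ∀ {d} → Form d → Index d → Fin 4
⟦ f ⟧ α = ∑ (λ k → f k ⟨$⟩ʳ α k)

Represents : ∀ {d} → Form d → Matrix d → Set
Represents f B = ∀ α → B α ≡ zeroIndicator (⟦ f ⟧ α)

∑-act : ∀ {d} (σ : Permutation′ d) τ (α : Index d) → ∑ (act σ τ α) ≡ ⟦ (λ k → τ (σ ⟨$⟩ˡ k)) ⟧ α
∑-act σ τ α = begin
  ∑ (act σ τ α)            ≡⟨ ℤ₄Sum.sum-cong-≗ (λ i → cong (λ k → τ k ⟨$⟩ʳ α (σ ⟨$⟩ʳ i)) (inverseˡ σ)) ⟨
  ∑ (λ i → h (σ ⟨$⟩ʳ i))   ≡⟨ ℤ₄Sum.sum-permute h σ ⟨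
  ∑ h                      ∎
  where
  open ≡-Reasoning
  h = λ k → τ (σ ⟨$⟩ˡ k) ⟨$⟩ʳ α k

represent : ∀ {d} {B : Matrix d} → Equivalent (M4 d) B → Σ (Form d) λ f → Represents f B
represent {d} (σ , τ , B≡M4) = (λ k → τ (σ ⟨$⟩ˡ k)) , λ α → begin
  _                               ≡⟨ B≡M4 α ⟩
  M4 d (act σ τ α)                ≡⟨ M4≡zeroIndicator∘∑ d _ ⟩
  zeroIndicator (∑ (act σ τ α))   ≡⟨ cong zeroIndicator (∑-act σ τ α) ⟩
  _                               ∎
  where open ≡-Reasoning

module _ {d} (f : Form d) where

  ⟦⟧-cong : ∀ {α β} → α ≗ β → ⟦ f ⟧ α ≡ ⟦ f ⟧ β
  ⟦⟧-cong α≗β = ℤ₄Sum.sum-cong-≗ (λ k → cong (f k ⟨$⟩ʳ_) (α≗β k))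

  ⟦⟧-updateAt : ∀ α k x → ⟦ f ⟧ (α [ k ]≔ x) ≡ ⟦ f ⟧ α +₄ ((f k ⟨$⟩ʳ x) +₄ -₄ (f k ⟨$⟩ʳ α k))
  ⟦⟧-updateAt = sum-updateAt ℤ₄ (λ k → f k ⟨$⟩ʳ_)

  root : Index d → Fin d → Fin 4
  root α k = f k ⟨$⟩ˡ ((f k ⟨$⟩ʳ α k) +₄ -₄ ⟦ f ⟧ α)

  ⟦⟧-root : ∀ α k → ⟦ f ⟧ (α [ k ]≔ root α k) ≡ 0F
  ⟦⟧-root α k = begin
    ⟦ f ⟧ (α [ k ]≔ root α k)           ≡⟨ ⟦⟧-updateAt α k _ ⟩
    F +₄ ((f k ⟨$⟩ʳ root α k) +₄ -₄ a)   ≡⟨ cong (λ z → F +₄ (z +₄ -₄ a)) (inverseʳ (f k)) ⟩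
    F +₄ ((a +₄ -₄ F) +₄ -₄ a)           ≡⟨ from-yes (all? λ u → all? λ v → u +₄ ((v +₄ -₄ u) +₄ -₄ v) F.≟ 0F) F a ⟩
    0F                                   ∎
    where
    open ≡-Reasoning
    F = ⟦ f ⟧ α
    a = f k ⟨$⟩ʳ α k

  root-unique : ∀ α k {x} → ⟦ f ⟧ (α [ k ]≔ x) ≡ 0F → x ≡ root α k
  root-unique α k {x} ≡0 = begin
    x                                          ≡⟨ inverseˡ (f k) ⟨
    f k ⟨$⟩ˡ (f k ⟨$⟩ʳ x)                       ≡⟨ cong (f k ⟨$⟩ˡ_) (solved (⟦ f ⟧ α) (f k ⟨$⟩ʳ α k) (f k ⟨$⟩ʳ x)
                                                    (trans (sym (⟦⟧-updateAt α k x)) ≡0)) ⟩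
    f k ⟨$⟩ˡ ((f k ⟨$⟩ʳ α k) +₄ -₄ ⟦ f ⟧ α)     ∎
    where
    open ≡-Reasoning
    solved : ∀ u v w → u +₄ (w +₄ -₄ v) ≡ 0F → w ≡ v +₄ -₄ u
    solved = from-yes (all? λ u → all? λ v → all? λ w → (u +₄ (w +₄ -₄ v) F.≟ 0F) →-dec (w F.≟ v +₄ -₄ u))

  ⟦⟧≡0⇒root : ∀ {α} k → ⟦ f ⟧ α ≡ 0F → α k ≡ root α k
  ⟦⟧≡0⇒root {α} k ≡0 = root-unique α k (trans (⟦⟧-cong (updateAt-id-local k α refl)) ≡0)

  root⇒⟦⟧≡0 : ∀ {α} k → α k ≡ root α k → ⟦ f ⟧ α ≡ 0F
  root⇒⟦⟧≡0 {α} k on-root = begin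
    ⟦ f ⟧ α                        ≡⟨ ⟦⟧-cong (updateAt-id-local k α refl) ⟨
    ⟦ f ⟧ (α [ k ]≔ α k)           ≡⟨ cong (λ x → ⟦ f ⟧ (α [ k ]≔ x)) on-root ⟩
    ⟦ f ⟧ (α [ k ]≔ root α k)      ≡⟨ ⟦⟧-root α k ⟩
    0F                             ∎
    where open ≡-Reasoning

  translate : Fin d → Fin 4 → Fin 4 → Fin 4
  translate k x t = f k ⟨$⟩ˡ ((f k ⟨$⟩ʳ x) +₄ t)

  exchange : ∀ {α j k} → ⟦ f ⟧ α ≡ 0F → j ≢ k → ∀ t →
             ⟦ f ⟧ (α [ j ]≔ translate j (α j) t [ k ]≔ translate k (α k) (-₄ t)) ≡ 0F
  exchange {α} {j} {k} ≡0 j≢k t = begin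
    ⟦ f ⟧ (α [ j ]≔ translate j (α j) t [ k ]≔ translate k (α k) (-₄ t))
      ≡⟨ sum-updateAt₂ ℤ₄ (λ i → f i ⟨$⟩ʳ_) α j≢k _ _ ⟩
    ⟦ f ⟧ α +₄ (((f j ⟨$⟩ʳ translate j (α j) t) +₄ -₄ a) +₄ ((f k ⟨$⟩ʳ translate k (α k) (-₄ t)) +₄ -₄ b))
      ≡⟨ cong₂ (λ x y → ⟦ f ⟧ α +₄ ((x +₄ -₄ a) +₄ (y +₄ -₄ b))) (inverseʳ (f j)) (inverseʳ (f k)) ⟩
    ⟦ f ⟧ α +₄ (((a +₄ t) +₄ -₄ a) +₄ ((b +₄ -₄ t) +₄ -₄ b))
      ≡⟨ cong (_+₄ (((a +₄ t) +₄ -₄ a) +₄ ((b +₄ -₄ t) +₄ -₄ b))) ≡0 ⟩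
    0F +₄ (((a +₄ t) +₄ -₄ a) +₄ ((b +₄ -₄ t) +₄ -₄ b))
      ≡⟨ from-yes (all? λ a → all? λ b → all? λ t →
                     0F +₄ (((a +₄ t) +₄ -₄ a) +₄ ((b +₄ -₄ t) +₄ -₄ b)) F.≟ 0F) a b t ⟩
    0F ∎
    where
    open ≡-Reasoning
    a = f j ⟨$⟩ʳ α j
    b = f k ⟨$⟩ʳ α k

  zero-through : ∀ {j k m} → j ≢ k → m ≢ j → m ≢ k → ∀ x y →
                 Σ (Index d) λ α → ⟦ f ⟧ α ≡ 0F × α j ≡ x × α k ≡ y
  zero-through {j} {k} {m} j≢k m≢j m≢k x y = γ [ m ]≔ root γ m , ⟦⟧-root γ m , at-j , at-k
    where
    γ = const 0F [ j ]≔ x [ k ]≔ y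
    at-j : (γ [ m ]≔ root γ m) j ≡ x
    at-j = trans (updateAt-minimal j m γ (m≢j ∘ sym))
                 (trans (updateAt-minimal j k _ j≢k) (updateAt-updates j (const 0F)))
    at-k : (γ [ m ]≔ root γ m) k ≡ y
    at-k = trans (updateAt-minimal k m γ (m≢k ∘ sym)) (updateAt-updates k (const 0F [ j ]≔ x))

module _ {d} {f : Form d} {B : Matrix d} (rep : Represents f B) where

  ⟦⟧≡0⇒≢0 : ∀ {α} → ⟦ f ⟧ α ≡ 0F → B α ≢ 0ℚ
  ⟦⟧≡0⇒≢0 {α} ≡0 B≡0 = zeroIndicator-0F≢0 (trans (cong zeroIndicator (sym ≡0)) (trans (sym (rep α)) B≡0))

  ≢0⇒⟦⟧≡0 : ∀ {α} → B α ≢ 0ℚ → ⟦ f ⟧ α ≡ 0F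
  ≢0⇒⟦⟧≡0 {α} ≢0 = zeroIndicator≢0 (λ ≡0 → ≢0 (trans (rep α) ≡0))

-- Block permutations

module XorSum = Algebra.Properties.CommutativeMonoid.Sum (AbelianGroup.commutativeMonoid xor-abelianGroup)
module XorGroup = Algebra.Properties.Group (AbelianGroup.group xor-abelianGroup)

xorAll≡sum : ∀ {d} (v : Fin d → Bool) → xorAll v ≡ XorSum.sum v
xorAll≡sum {zero}  v = refl
xorAll≡sum {suc d} v = cong (v 0F xor_) (xorAll≡sum (v ∘ suc))

parity : ∀ {d} → BPParams d → Index d → Bool
parity P α = xorAll (pvec P α)

parity-updateAt₂ : ∀ {d} (P : BPParams d) α {j k} → j ≢ k → ∀ x y →
                   parity P (α [ j ]≔ x [ k ]≔ y) ≡
                   parity P α xor ((pmap (eps P j) x xor pmap (eps P j) (α j)) xor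
                                   (pmap (eps P k) y xor pmap (eps P k) (α k)))
parity-updateAt₂ P α {j} {k} j≢k x y = begin
  parity P (α [ j ]≔ x [ k ]≔ y)              ≡⟨ xorAll≡sum (pvec P (α [ j ]≔ x [ k ]≔ y)) ⟩
  XorSum.sum (pvec P (α [ j ]≔ x [ k ]≔ y))   ≡⟨ sum-updateAt₂ xor-abelianGroup (λ i → pmap (eps P i)) α j≢k x y ⟩
  XorSum.sum (pvec P α) xor change            ≡⟨ cong (_xor change) (xorAll≡sum (pvec P α)) ⟨
  parity P α xor change                       ∎
  where
  open ≡-Reasoning
  change = (pmap (eps P j) x xor pmap (eps P j) (α j)) xor (pmap (eps P k) y xor pmap (eps P k) (α k))

blockPerm-support : ∀ {d} {B : Matrix d} {P} → IsBlockPerm B P → ∀ {α} → B α ≢ 0ℚ → parity P α ≡ s P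
blockPerm-support {P = P} isBP {α} ≢0 = first-conjunct (parity P α Bool.≟ s P) (λ ≡0 → ≢0 (trans (isBP α) ≡0))
  where
  first-conjunct : ∀ {A : Set} (a? : Dec A) {b} → indicator (⌊ a? ⌋ ∧ b) ≢ 0ℚ → A
  first-conjunct (yes a) _  = a
  first-conjunct (no _)  ≢0 = contradiction refl ≢0

noNewEntries-at : ∀ {d} {M N : Matrix d} {P} → NoNewEntries M P N →
                  ∀ {α} → parity P α ≡ s P → N α ≢ 0ℚ → M α ≢ 0ℚ
noNewEntries-at nne {α} onParity = nne _ onParity α (λ _ → refl)

module _ {d} {f : Form d} {B : Matrix d} {P : BPParams d} (rep : Represents f B) (isBP : IsBlockPerm B P) where

  parityChange : Fin d → Fin 4 → Fin 4 → Bool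
  parityChange k t x = pmap (eps P k) (translate f k x t) xor pmap (eps P k) x

  -- Translating αⱼ by t and αₖ by −t stays inside supp B, all of which has parity s.
  parity-exchange : ∀ {α j k} → ⟦ f ⟧ α ≡ 0F → j ≢ k → ∀ t →
                    parityChange j t (α j) ≡ parityChange k (-₄ t) (α k)
  parity-exchange {α} {j} {k} ≡0 j≢k t =
    XorGroup.inverseˡ-unique _ _ (XorGroup.identityʳ-unique (parity P α) _ (begin
      parity P α xor (parityChange j t (α j) xor parityChange k (-₄ t) (α k))
        ≡⟨ parity-updateAt₂ P α j≢k (translate f j (α j) t) (translate f k (α k) (-₄ t)) ⟨
      parity P β                                                              ≡⟨ on-parity (exchange f ≡0 j≢k t) ⟩
      s P                                                                     ≡⟨ on-parity ≡0 ⟨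
      parity P α                                                              ∎))
    where
    open ≡-Reasoning
    β = α [ j ]≔ translate f j (α j) t [ k ]≔ translate f k (α k) (-₄ t)
    on-parity : ∀ {γ} → ⟦ f ⟧ γ ≡ 0F → parity P γ ≡ s P
    on-parity ≡0 = blockPerm-support {P = P} isBP (⟦⟧≡0⇒≢0 {f = f} rep ≡0)

  parityChange-constant : ∀ {j k m} → j ≢ k → m ≢ j → m ≢ k → ∀ x →
                          parityChange j 1F x ≡ parityChange k (-₄ 1F) 0F
  parityChange-constant j≢k m≢j m≢k x with zero-through f j≢k m≢j m≢k x 0F
  ... | α , ≡0 , αj≡x , αk≡0 =
    subst₂ (λ a b → parityChange _ 1F a ≡ parityChange _ (-₄ 1F) b) αj≡x αk≡0 (parity-exchange ≡0 j≢k 1F)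

  -- The third direction m leaves room for a zero through every (x, 0) in directions (j, k), so
  -- the parity change of a unit step in direction j equals that of a fixed step in direction k.
  -- Being independent of x, two consecutive unit steps cancel.
  oddness : ∀ {j k m} → j ≢ k → m ≢ j → m ≢ k → ∀ {x y} →
            f j ⟨$⟩ʳ y ≡ (f j ⟨$⟩ʳ x) +₄ 2F → pmap (eps P j) x ≡ pmap (eps P j) y
  oddness {j} j≢k m≢j m≢k {x} {y} y≡x+2 = begin
    p x    ≡⟨ XorGroup.∙-cancelˡ (p x₁) _ _ (trans (same-change x) (xor-comm (p x₂) (p x₁))) ⟩
    p x₂   ≡⟨ cong p x₂≡y ⟩
    p y    ∎
    where
    open ≡-Reasoning
    p = pmap (eps P j)
    x₁ = translate f j x 1F
    x₂ = translate f j x₁ 1F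
    same-change : ∀ x → parityChange j 1F x ≡ parityChange j 1F (translate f j x 1F)
    same-change x = trans (parityChange-constant j≢k m≢j m≢k x)
                          (sym (parityChange-constant j≢k m≢j m≢k (translate f j x 1F)))
    two-steps : ∀ a → (a +₄ 1F) +₄ 1F ≡ a +₄ 2F
    two-steps = from-yes (all? λ a → (a +₄ 1F) +₄ 1F F.≟ a +₄ 2F)
    x₂≡y : x₂ ≡ y
    x₂≡y = begin
      f j ⟨$⟩ˡ ((f j ⟨$⟩ʳ x₁) +₄ 1F)              ≡⟨ cong (λ z → f j ⟨$⟩ˡ (z +₄ 1F)) (inverseʳ (f j)) ⟩
      f j ⟨$⟩ˡ (((f j ⟨$⟩ʳ x) +₄ 1F) +₄ 1F)       ≡⟨ cong (f j ⟨$⟩ˡ_) (two-steps (f j ⟨$⟩ʳ x)) ⟩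
      f j ⟨$⟩ˡ ((f j ⟨$⟩ʳ x) +₄ 2F)               ≡⟨ cong (f j ⟨$⟩ˡ_) y≡x+2 ⟨
      f j ⟨$⟩ˡ (f j ⟨$⟩ʳ y)                       ≡⟨ inverseˡ (f j) ⟩
      y                                           ∎

-- The tessellation index

⌊⌋≡true⇒ : ∀ {A : Set} (a? : Dec A) → ⌊ a? ⌋ ≡ true → A
⌊⌋≡true⇒ (yes a) _ = a
⌊⌋≡true⇒ (no _)  ()

⌊⌋≡false⇒¬ : ∀ {A : Set} (a? : Dec A) → ⌊ a? ⌋ ≡ false → ¬ A
⌊⌋≡false⇒¬ (yes _) ()
⌊⌋≡false⇒¬ (no ¬a) _ = ¬a

countFin-cong : ∀ {d} {g h : Fin d → Bool} → g ≗ h → countFin g ≡ countFin h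
countFin-cong {zero}  _   = refl
countFin-cong {suc d} g≗h = cong₂ (λ b c → (if b then 1 else 0) ℕ.+ c) (g≗h 0F) (countFin-cong (g≗h ∘ suc))

countFin-≤ : ∀ {d} (g : Fin d → Bool) → countFin g ℕ.≤ d
countFin-≤ {zero}  g = ℕ.z≤n
countFin-≤ {suc d} g with g 0F
... | true  = ℕ.s≤s (countFin-≤ (g ∘ suc))
... | false = m≤n⇒m≤1+n (countFin-≤ (g ∘ suc))

countFin≡d⇒all : ∀ {d} (g : Fin d → Bool) → countFin g ≡ d → ∀ i → g i ≡ true
countFin≡d⇒all {suc d} g count≡ i with g 0F in g0≡
countFin≡d⇒all {suc d} g count≡ 0F      | true  = g0≡
countFin≡d⇒all {suc d} g count≡ (suc i) | true  = countFin≡d⇒all (g ∘ suc) (suc-injective count≡) i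
countFin≡d⇒all {suc d} g count≡ i       | false = contradiction (subst (ℕ._≤ d) count≡ (countFin-≤ (g ∘ suc))) 1+n≰n

countFin-single-false : ∀ {n} (g : Fin (suc n) → Bool) → countFin g ≡ n →
                        Σ (Fin (suc n)) λ j → g j ≡ false × (∀ i → i ≢ j → g i ≡ true)
countFin-single-false {n} g count≡ with g 0F in g0≡
countFin-single-false {zero}  g () | true
countFin-single-false {suc n} g count≡ | true with countFin-single-false (g ∘ suc) (suc-injective count≡)
... | j , gj≡false , others = suc j , gj≡false , λ where
  0F      _     → g0≡
  (suc i) i≢1+j → others i (i≢1+j ∘ cong suc)
countFin-single-false {n} g count≡ | false = 0F , g0≡ , λ where
  0F      0≢0 → contradiction refl 0≢0
  (suc i) _   → countFin≡d⇒all (g ∘ suc) count≡ i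

blockMeet : Fin 3 → Bool → Fin 3 → Bool → ℕ
blockMeet e b e' b' = count4 (λ x → ⌊ pmap e x Bool.≟ b ⌋ ∧ ⌊ pmap e' x Bool.≟ b' ⌋)

blockMeet≟2 : ∀ e e' a → ⌊ blockMeet e (pmap e a) e' (pmap e' a) ℕ.≟ 2 ⌋ ≡ ⌊ e F.≟ e' ⌋
blockMeet≟2 = from-yes (all? λ e → all? λ e' → all? λ a →
  ⌊ blockMeet e (pmap e a) e' (pmap e' a) ℕ.≟ 2 ⌋ Bool.≟ ⌊ e F.≟ e' ⌋)

intersectionDim-agreements : ∀ {d} {P P' : BPParams d} {y y'} → Intersect P y P' y' →
                             intersectionDim P y P' y' ≡ countFin (λ i → ⌊ eps P i F.≟ eps P' i ⌋)
intersectionDim-agreements {P = P} {P'} (α , inC , inC') = countFin-cong λ i →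
  subst₂ (λ b b' → ⌊ blockMeet (eps P i) b (eps P' i) b' ℕ.≟ 2 ⌋ ≡ _)
         (inC i) (inC' i) (blockMeet≟2 (eps P i) (eps P' i) (α i))

tessellation-single-difference : ∀ {n} {P P' : BPParams (suc n)} → TessIndexEq P P' n →
  Σ (Fin (suc n)) λ j → eps P j ≢ eps P' j × (∀ i → i ≢ j → eps P i ≡ eps P' i)
tessellation-single-difference {P = P} {P'} ((_ , _ , _ , _ , meet , dim≡n) , _)
  with countFin-single-false _ (trans (sym (intersectionDim-agreements {P = P} {P'} meet)) dim≡n)
... | j , disagree , agree =
  j , ⌊⌋≡false⇒¬ (eps P j F.≟ eps P' j) disagree , λ i i≢j → ⌊⌋≡true⇒ (eps P i F.≟ eps P' i) (agree i i≢j)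

-- Comparing B and B' along the exceptional direction

transpose-matchˡ : ∀ {n} (i j : Fin n) → PC.transpose i j i ≡ j
transpose-matchˡ i j rewrite dec-true (i F.≟ i) refl = refl

transpose-matchʳ : ∀ {n} (i j : Fin n) → PC.transpose i j j ≡ i
transpose-matchʳ i j with j F.≟ i
... | yes j≡i = j≡i
... | no _ rewrite dec-true (j F.≟ j) refl = refl

transpose-other : ∀ {n} {i j k : Fin n} → k ≢ i → k ≢ j → PC.transpose i j k ≡ k
transpose-other {i = i} {j} {k} k≢i k≢j rewrite dec-false (k F.≟ i) k≢i | dec-false (k F.≟ j) k≢j = refl

transpose-involutive : ∀ {n} (i j k : Fin n) → PC.transpose i j (PC.transpose i j k) ≡ k
transpose-involutive i j k = by-cases (k F.≟ i) (k F.≟ j)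
  where
  swap = PC.transpose i j
  involutive-at : ∀ {z} → swap (swap z) ≡ z → k ≡ z → swap (swap k) ≡ k
  involutive-at at-z k≡z = subst (λ x → swap (swap x) ≡ x) (sym k≡z) at-z
  by-cases : Dec (k ≡ i) → Dec (k ≡ j) → swap (swap k) ≡ k
  by-cases (yes k≡i) _       = involutive-at (trans (cong swap (transpose-matchˡ i j)) (transpose-matchʳ i j)) k≡i
  by-cases (no _) (yes k≡j)  = involutive-at (trans (cong swap (transpose-matchʳ i j)) (transpose-matchˡ i j)) k≡j
  by-cases (no k≢i) (no k≢j) = trans (cong swap (transpose-other k≢i k≢j)) (transpose-other k≢i k≢j)

discrepancy : Fin 3 → Fin 3 → Fin 4 → Bool
discrepancy e e' x = pmap e x xor pmap e' x

record Crossing (e e' : Fin 3) (t : Bool) : Set where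
  field
    m₁ m₂     : Fin 4
    m₁-off    : discrepancy e e' m₁ ≢ t
    m₂-off    : discrepancy e e' m₂ ≢ t
    separated : pmap e m₁ ≢ pmap e m₂
    covers    : ∀ x → discrepancy e e' x ≢ t → x ≡ m₁ ⊎ x ≡ m₂

Crossing-swap : ∀ {e e' t} → Crossing e e' t → Crossing e e' t
Crossing-swap C = record
  { m₁ = m₂ ; m₂ = m₁ ; m₁-off = m₂-off ; m₂-off = m₁-off
  ; separated = separated ∘ sym ; covers = Sum.swap ∘₂ covers }
  where open Crossing C

crossingAt : ∀ {e e' t} m₁ m₂ →
             {True (¬? (discrepancy e e' m₁ Bool.≟ t))} → {True (¬? (discrepancy e e' m₂ Bool.≟ t))} →
             {True (¬? (pmap e m₁ Bool.≟ pmap e m₂))} →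
             {True (all? λ x → ¬? (discrepancy e e' x Bool.≟ t) →-dec (x F.≟ m₁ ⊎-dec x F.≟ m₂))} →
             Crossing e e' t
crossingAt m₁ m₂ {off₁} {off₂} {sep} {cov} = record
  { m₁ = m₁ ; m₂ = m₂ ; m₁-off = toWitness off₁ ; m₂-off = toWitness off₂
  ; separated = toWitness sep ; covers = toWitness cov }

-- For e ≢ e' the discrepancy p_e ⊕ p_e' is the third pairing of {0,1,2,3};
-- each of its blocks meets both blocks of p_e.
crossing : ∀ e e' → e ≢ e' → ∀ t → Crossing e e' t
crossing 0F 1F _ false = crossingAt 1F 2F
crossing 0F 1F _ true  = crossingAt 0F 3F
crossing 1F 0F _ false = crossingAt 1F 2F
crossing 1F 0F _ true  = crossingAt 0F 3F
crossing 0F 2F _ false = crossingAt 1F 3F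
crossing 0F 2F _ true  = crossingAt 0F 2F
crossing 2F 0F _ false = crossingAt 1F 3F
crossing 2F 0F _ true  = crossingAt 0F 2F
crossing 1F 2F _ false = crossingAt 2F 3F
crossing 1F 2F _ true  = crossingAt 0F 1F
crossing 2F 1F _ false = crossingAt 2F 3F
crossing 2F 1F _ true  = crossingAt 0F 1F
crossing 0F 0F e≢e' _  = contradiction refl e≢e'
crossing 1F 1F e≢e' _  = contradiction refl e≢e'
crossing 2F 2F e≢e' _  = contradiction refl e≢e'

xor-shift : ∀ s s' → s xor (s xor s') ≡ s'
xor-shift s s' = trans (sym (xor-assoc s s s')) (cong (_xor s') (xor-same s))

module RootTransfer {d} {f f' : Form d} {B B' : Matrix d} {P P' : BPParams d}
  (rep : Represents f B) (rep' : Represents f' B') (isBP : IsBlockPerm B P) (isBP' : IsBlockPerm B' P')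
  (j : Fin d) (agree : ∀ i → i ≢ j → eps P i ≡ eps P' i) where

  δ : Fin 4 → Bool
  δ = discrepancy (eps P j) (eps P' j)

  parity-relation : ∀ γ → parity P' γ ≡ parity P γ xor δ (γ j)
  parity-relation γ = begin
    parity P' γ                                        ≡⟨ xorAll≡sum (pvec P' γ) ⟩
    XorSum.sum (pvec P' γ)                             ≡⟨ XorSum.sum-cong-≗ pvec-relation ⟩
    XorSum.sum (pvec P γ [ j ]≔ p' (γ j))              ≡⟨ sum-updateAt xor-abelianGroup (λ _ b → b) (pvec P γ) j (p' (γ j)) ⟩
    XorSum.sum (pvec P γ) xor (p' (γ j) xor p (γ j))   ≡⟨ cong₂ _xor_ (sym (xorAll≡sum (pvec P γ)))
                                                                      (xor-comm (p' (γ j)) (p (γ j))) ⟩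
    parity P γ xor δ (γ j)                             ∎
    where
    open ≡-Reasoning
    p = pmap (eps P j)
    p' = pmap (eps P' j)
    pvec-relation : pvec P' γ ≗ pvec P γ [ j ]≔ p' (γ j)
    pvec-relation i with i F.≟ j
    ... | yes refl = sym (updateAt-updates i (pvec P γ))
    ... | no i≢j   = trans (cong (λ e → pmap e (γ i)) (sym (agree i i≢j))) (sym (updateAt-minimal i j (pvec P γ) i≢j))

  root-transfer : NoNewEntries B' P' B → ∀ α → δ (root f α j) ≡ s P xor s P' → root f' α j ≡ root f α j
  root-transfer nne' α δc≡t =
    sym (root-unique f' α j (≢0⇒⟦⟧≡0 {f = f'} rep' (noNewEntries-at {P = P'} nne' on-parity′ B≢0)))
    where
    open ≡-Reasoning
    β = α [ j ]≔ root f α j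
    B≢0 : B β ≢ 0ℚ
    B≢0 = ⟦⟧≡0⇒≢0 {f = f} rep (⟦⟧-root f α j)
    on-parity′ : parity P' β ≡ s P'
    on-parity′ = begin
      parity P' β              ≡⟨ parity-relation β ⟩
      parity P β xor δ (β j)   ≡⟨ cong₂ _xor_ (blockPerm-support {P = P} isBP B≢0)
                                          (trans (cong δ (updateAt-updates j α)) δc≡t) ⟩
      s P xor (s P xor s P')   ≡⟨ xor-shift (s P) (s P') ⟩
      s P'                     ∎

  roots-coincide : ∀ α → root f α j ≡ root f' α j → δ (root f α j) ≡ s P xor s P'
  roots-coincide α c≡c' = XorGroup.∙-cancelˡ (s P) _ _ (begin
    s P xor δ (root f α j)   ≡⟨ cong₂ _xor_ (blockPerm-support {P = P} isBP B≢0) (cong δ (updateAt-updates j α)) ⟨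
    parity P β xor δ (β j)   ≡⟨ parity-relation β ⟨
    parity P' β              ≡⟨ blockPerm-support {P = P'} isBP' B'≢0 ⟩
    s P'                     ≡⟨ xor-shift (s P) (s P') ⟨
    s P xor (s P xor s P')   ∎)
    where
    open ≡-Reasoning
    β = α [ j ]≔ root f α j
    B≢0 : B β ≢ 0ℚ
    B≢0 = ⟦⟧≡0⇒≢0 {f = f} rep (⟦⟧-root f α j)
    B'≢0 : B' β ≢ 0ℚ
    B'≢0 = ⟦⟧≡0⇒≢0 {f = f'} rep' (subst (λ x → ⟦ f' ⟧ (α [ j ]≔ x) ≡ 0F) (sym c≡c') (⟦⟧-root f' α j))

module Reflection {d} {f f' : Form d} {B B' : Matrix d} {P P' : BPParams d}
  (rep : Represents f B) (rep' : Represents f' B') (isBP : IsBlockPerm B P) (isBP' : IsBlockPerm B' P')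
  (nne : NoNewEntries B P B') (nne' : NoNewEntries B' P' B)
  (j : Fin d) (agree : ∀ i → i ≢ j → eps P i ≡ eps P' i) (C : Crossing (eps P j) (eps P' j) (s P xor s P')) where

  open Crossing C
  open RootTransfer {f = f} {f'} {P = P} {P'} rep rep' isBP isBP' j agree
  private module Mirror = RootTransfer {f = f'} {f} {P = P'} {P} rep' rep isBP' isBP j (λ i i≢j → sym (agree i i≢j))

  π : Fin 4 → Fin 4
  π = PC.transpose m₁ m₂

  -- A B-root of discrepancy s ⊕ s' lies in supp B' by the no-new-entries hypothesis; otherwise
  -- neither root has that discrepancy and they differ, so they are the two points of the crossing.
  root′≡π-root : ∀ α → root f' α j ≡ π (root f α j)
  root′≡π-root α = by-cases (δ c Bool.≟ t) (δ c' Bool.≟ t)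
    where
    t = s P xor s P'
    c = root f α j
    c' = root f' α j
    from-covers : c ≢ c' → c ≡ m₁ ⊎ c ≡ m₂ → c' ≡ m₁ ⊎ c' ≡ m₂ → c' ≡ π c
    from-covers c≢c' (inj₁ c≡m₁) (inj₁ c'≡m₁) = contradiction (trans c≡m₁ (sym c'≡m₁)) c≢c'
    from-covers _    (inj₁ c≡m₁) (inj₂ c'≡m₂) = trans c'≡m₂ (trans (sym (transpose-matchˡ m₁ m₂)) (cong π (sym c≡m₁)))
    from-covers _    (inj₂ c≡m₂) (inj₁ c'≡m₁) = trans c'≡m₁ (trans (sym (transpose-matchʳ m₁ m₂)) (cong π (sym c≡m₂)))
    from-covers c≢c' (inj₂ c≡m₂) (inj₂ c'≡m₂) = contradiction (trans c≡m₂ (sym c'≡m₂)) c≢c'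
    by-cases : Dec (δ c ≡ t) → Dec (δ c' ≡ t) → c' ≡ π c
    by-cases (yes δc≡t) _ = trans (root-transfer nne' α δc≡t) (sym (transpose-other (off m₁-off) (off m₂-off)))
      where
      off : ∀ {m} → δ m ≢ t → c ≢ m
      off δm≢t c≡m = δm≢t (subst (λ x → δ x ≡ t) c≡m δc≡t)
    by-cases (no δc≢t) (yes δc'≡t) = contradiction (subst (λ x → δ x ≡ t) (sym c≡c') δc'≡t) δc≢t
      where
      c≡c' : c ≡ c'
      c≡c' = Mirror.root-transfer nne α
               (trans (xor-comm (pmap (eps P' j) c') (pmap (eps P j) c')) (trans δc'≡t (xor-comm (s P) (s P'))))
    by-cases (no δc≢t) (no δc'≢t) = from-covers (δc≢t ∘ roots-coincide α) (covers c δc≢t) (covers c' δc'≢t)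

  reflection : ∀ α → B' α ≡ B (α [ j ]≔ π (α j))
  reflection α = trans (rep' α) (trans (zeroIndicator-cong reflect unreflect) (sym (rep (α [ j ]≔ π (α j)))))
    where
    open ≡-Reasoning
    reflect : ⟦ f' ⟧ α ≡ 0F → ⟦ f ⟧ (α [ j ]≔ π (α j)) ≡ 0F
    reflect ≡0 = subst (λ x → ⟦ f ⟧ (α [ j ]≔ x) ≡ 0F) (sym (begin
      π (α j)               ≡⟨ cong π (⟦⟧≡0⇒root f' j ≡0) ⟩
      π (root f' α j)       ≡⟨ cong π (root′≡π-root α) ⟩
      π (π (root f α j))    ≡⟨ transpose-involutive m₁ m₂ _ ⟩
      root f α j            ∎)) (⟦⟧-root f α j)
    unreflect : ⟦ f ⟧ (α [ j ]≔ π (α j)) ≡ 0F → ⟦ f' ⟧ α ≡ 0F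
    unreflect ≡0 = root⇒⟦⟧≡0 f' j (begin
      α j                   ≡⟨ transpose-involutive m₁ m₂ (α j) ⟨
      π (π (α j))           ≡⟨ cong π (root-unique f α j ≡0) ⟩
      π (root f α j)        ≡⟨ root′≡π-root α ⟨
      root f' α j           ∎)

-- Normal form

orient-crossing : ∀ {e e' t} (g : Permutation′ 4) →
                  (∀ {x y} → g ⟨$⟩ʳ y ≡ (g ⟨$⟩ʳ x) +₄ 2F → pmap e x ≡ pmap e y) →
                  Crossing e e' t → Σ (Crossing e e' t) λ C → g ⟨$⟩ʳ Crossing.m₂ C ≡ (g ⟨$⟩ʳ Crossing.m₁ C) +₄ 1F
orient-crossing {e} g opposite⇒same C =
  Sum.[ (λ up → C , up) , (λ down → Crossing-swap C , down) ]′
    (adjacent (g ⟨$⟩ʳ m₁) (g ⟨$⟩ʳ m₂) (separated ∘ cong (pmap e) ∘ sym ∘ g-injective) (separated ∘ opposite⇒same))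
  where
  open Crossing C
  g-injective = Injection.injective (Inverse⇒Injection g)
  adjacent : ∀ u v → v ≢ u → v ≢ u +₄ 2F → v ≡ u +₄ 1F ⊎ u ≡ v +₄ 1F
  adjacent = from-yes (all? λ u → all? λ v →
    ¬? (v F.≟ u) →-dec (¬? (v F.≟ u +₄ 2F) →-dec (v F.≟ u +₄ 1F ⊎-dec u F.≟ v +₄ 1F)))

swap01-conjugate : ∀ (g : Permutation′ 4) {lo hi} → g ⟨$⟩ʳ hi ≡ (g ⟨$⟩ʳ lo) +₄ 1F → ∀ x →
                   swap01 (-₄ (g ⟨$⟩ʳ lo) +₄ (g ⟨$⟩ʳ x)) ≡ -₄ (g ⟨$⟩ʳ lo) +₄ (g ⟨$⟩ʳ PC.transpose lo hi x)
swap01-conjugate g {lo} {hi} hi≡lo+1 x = by-cases (x F.≟ lo) (x F.≟ hi)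
  where
  open ≡-Reasoning
  u = g ⟨$⟩ʳ lo
  h : Fin 4 → Fin 4
  h z = -₄ u +₄ (g ⟨$⟩ʳ z)
  by-cases : Dec (x ≡ lo) → Dec (x ≡ hi) → swap01 (h x) ≡ h (PC.transpose lo hi x)
  by-cases (yes x≡lo) _ = begin
    swap01 (h x)                  ≡⟨ cong (swap01 ∘ h) x≡lo ⟩
    swap01 (-₄ u +₄ u)            ≡⟨ from-yes (all? λ u → swap01 (-₄ u +₄ u) F.≟ -₄ u +₄ (u +₄ 1F)) u ⟩
    -₄ u +₄ (u +₄ 1F)             ≡⟨ cong (-₄ u +₄_) hi≡lo+1 ⟨
    h hi                          ≡⟨ cong h (transpose-matchˡ lo hi) ⟨
    h (PC.transpose lo hi lo)     ≡⟨ cong (h ∘ PC.transpose lo hi) x≡lo ⟨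
    h (PC.transpose lo hi x)      ∎
  by-cases (no _) (yes x≡hi) = begin
    swap01 (h x)                  ≡⟨ cong (swap01 ∘ h) x≡hi ⟩
    swap01 (-₄ u +₄ (g ⟨$⟩ʳ hi))  ≡⟨ cong (λ v → swap01 (-₄ u +₄ v)) hi≡lo+1 ⟩
    swap01 (-₄ u +₄ (u +₄ 1F))    ≡⟨ from-yes (all? λ u → swap01 (-₄ u +₄ (u +₄ 1F)) F.≟ -₄ u +₄ u) u ⟩
    h lo                          ≡⟨ cong h (transpose-matchʳ lo hi) ⟨
    h (PC.transpose lo hi hi)     ≡⟨ cong (h ∘ PC.transpose lo hi) x≡hi ⟨
    h (PC.transpose lo hi x)      ∎
  by-cases (no x≢lo) (no x≢hi) = begin
    swap01 (h x)                  ≡⟨ fixed u (g ⟨$⟩ʳ x) (x≢lo ∘ g-injective) (x≢hi ∘ g-injective ∘ flip trans (sym hi≡lo+1)) ⟩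
    h x                           ≡⟨ cong h (transpose-other x≢lo x≢hi) ⟨
    h (PC.transpose lo hi x)      ∎
    where
    g-injective = Injection.injective (Inverse⇒Injection g)
    fixed : ∀ u v → v ≢ u → v ≢ u +₄ 1F → swap01 (-₄ u +₄ v) ≡ -₄ u +₄ v
    fixed = from-yes (all? λ u → all? λ v →
      ¬? (v F.≟ u) →-dec (¬? (v F.≟ u +₄ 1F) →-dec (swap01 (-₄ u +₄ v) F.≟ -₄ u +₄ v)))

-- σ moves direction j to the last position; the offsets −u there and u in position 0 cancel
-- in the sum and shift the last coordinate so that fⱼ⁻¹(u) and fⱼ⁻¹(u + 1) land on 0 and 1.
module NormalForm {n} (f : Form (2 + n)) (j : Fin (2 + n)) (u : Fin 4) where

  lastPos : Fin (2 + n)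
  lastPos = F.fromℕ (suc n)

  σ : Permutation′ (2 + n)
  σ = transpose lastPos j

  translation : Fin 4 → Permutation′ 4
  translation c = permutation (c +₄_) (-₄ c +₄_)
    (from-yes (all? λ c → all? λ y → c +₄ (-₄ c +₄ y) F.≟ y) c)
    (from-yes (all? λ c → all? λ y → -₄ c +₄ (c +₄ y) F.≟ y) c)

  offset : Fin (2 + n) → Fin 4
  offset = const 0F [ lastPos ]≔ (-₄ u) [ 0F ]≔ u

  τ : Fin (2 + n) → Permutation′ 4
  τ i = f (σ ⟨$⟩ʳ i) ∘ₚ translation (offset i)

  ∑-offset : ∑ offset ≡ 0F
  ∑-offset = begin
    ∑ offset
      ≡⟨ sum-updateAt₂ ℤ₄ (λ _ x → x) (const 0F) {lastPos} {0F} (λ ()) (-₄ u) u ⟩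
    ∑ {2 + n} (const 0F) +₄ ((-₄ u +₄ -₄ 0F) +₄ (u +₄ -₄ 0F))
      ≡⟨ cong (_+₄ ((-₄ u +₄ -₄ 0F) +₄ (u +₄ -₄ 0F))) (ℤ₄Sum.sum-replicate-zero (2 + n)) ⟩
    0F +₄ ((-₄ u +₄ -₄ 0F) +₄ (u +₄ -₄ 0F))
      ≡⟨ from-yes (all? λ u → 0F +₄ ((-₄ u +₄ -₄ 0F) +₄ (u +₄ -₄ 0F)) F.≟ 0F) u ⟩
    0F ∎
    where open ≡-Reasoning

  ∑-act≡⟦f⟧ : ∀ α → ∑ (act σ τ α) ≡ ⟦ f ⟧ α
  ∑-act≡⟦f⟧ α = begin
    ∑ (act σ τ α)                           ≡⟨ ℤ₄Sum.∑-distrib-+ offset (λ i → h (σ ⟨$⟩ʳ i)) ⟩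
    ∑ offset +₄ ∑ (λ i → h (σ ⟨$⟩ʳ i))      ≡⟨ cong₂ _+₄_ ∑-offset (sym (ℤ₄Sum.sum-permute h σ)) ⟩
    0F +₄ ∑ h                               ≡⟨ AbelianGroup.identityˡ ℤ₄ (∑ h) ⟩
    ⟦ f ⟧ α                                 ∎
    where
    open ≡-Reasoning
    h = λ k → f k ⟨$⟩ʳ α k

  act-lastPos : ∀ α → act σ τ α lastPos ≡ -₄ u +₄ (f j ⟨$⟩ʳ α j)
  act-lastPos α = cong₂ (λ c k → c +₄ (f k ⟨$⟩ʳ α k)) offset-lastPos (transpose-matchˡ lastPos j)
    where
    offset-lastPos : offset lastPos ≡ -₄ u
    offset-lastPos = trans (updateAt-minimal lastPos 0F {const u} (const 0F [ lastPos ]≔ (-₄ u)) (λ ()))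
                           (updateAt-updates lastPos (const 0F))

  act-updateAt-away : ∀ α x {i} → i ≢ lastPos → act σ τ (α [ j ]≔ x) i ≡ act σ τ α i
  act-updateAt-away α x {i} i≢last =
    cong (λ z → offset i +₄ (f (σ ⟨$⟩ʳ i) ⟨$⟩ʳ z)) (updateAt-minimal (σ ⟨$⟩ʳ i) j α σi≢j)
    where
    σi≢j : σ ⟨$⟩ʳ i ≢ j
    σi≢j σi≡j = i≢last (begin
      i                                             ≡⟨ PC.transpose-inverse j lastPos ⟨
      PC.transpose j lastPos (σ ⟨$⟩ʳ i)             ≡⟨ cong (PC.transpose j lastPos) σi≡j ⟩
      PC.transpose j lastPos j                      ≡⟨ transpose-matchˡ j lastPos ⟩
      lastPos                                       ∎)
      where open ≡-Reasoning

  piLast-lastPos : ∀ γ → piLast (2 + n) γ lastPos ≡ swap01 (γ lastPos)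
  piLast-lastPos γ with toℕ lastPos ℕ.≟ suc n
  ... | yes _      = refl
  ... | no ≢suc-n  = contradiction (toℕ-fromℕ (suc n)) ≢suc-n

  piLast-away : ∀ γ {i} → i ≢ lastPos → piLast (2 + n) γ i ≡ γ i
  piLast-away γ {i} i≢last with toℕ i ℕ.≟ suc n
  ... | yes ≡suc-n = contradiction (toℕ-injective (trans ≡suc-n (sym (toℕ-fromℕ (suc n))))) i≢last
  ... | no _       = refl

  normal-form : ∀ {B B' : Matrix (2 + n)} (π : Fin 4 → Fin 4) → Represents f B →
                (∀ α → B' α ≡ B (α [ j ]≔ π (α j))) →
                (∀ x → swap01 (-₄ u +₄ (f j ⟨$⟩ʳ x)) ≡ -₄ u +₄ (f j ⟨$⟩ʳ π x)) →
                ∀ α → B α ≡ M4 (2 + n) (act σ τ α) × B' α ≡ Mπ (2 + n) (act σ τ α)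
  normal-form {B} {B'} π rep reflection conjugate = λ α → B≡ α , B'≡ α
    where
    open ≡-Reasoning
    B≡ : ∀ α → B α ≡ M4 (2 + n) (act σ τ α)
    B≡ α = begin
      B α                              ≡⟨ rep α ⟩
      zeroIndicator (⟦ f ⟧ α)          ≡⟨ cong zeroIndicator (∑-act≡⟦f⟧ α) ⟨
      zeroIndicator (∑ (act σ τ α))    ≡⟨ M4≡zeroIndicator∘∑ (2 + n) (act σ τ α) ⟨
      M4 (2 + n) (act σ τ α)           ∎
    piLast-act : ∀ α → piLast (2 + n) (act σ τ α) ≗ act σ τ (α [ j ]≔ π (α j))
    piLast-act α i = by-cases (i F.≟ lastPos)
      where
      β = α [ j ]≔ π (α j)
      at-lastPos : piLast (2 + n) (act σ τ α) lastPos ≡ act σ τ β lastPos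
      at-lastPos = begin
        piLast (2 + n) (act σ τ α) lastPos     ≡⟨ piLast-lastPos (act σ τ α) ⟩
        swap01 (act σ τ α lastPos)             ≡⟨ cong swap01 (act-lastPos α) ⟩
        swap01 (-₄ u +₄ (f j ⟨$⟩ʳ α j))        ≡⟨ conjugate (α j) ⟩
        -₄ u +₄ (f j ⟨$⟩ʳ π (α j))             ≡⟨ cong (λ x → -₄ u +₄ (f j ⟨$⟩ʳ x)) (updateAt-updates j α) ⟨
        -₄ u +₄ (f j ⟨$⟩ʳ β j)                 ≡⟨ act-lastPos β ⟨
        act σ τ β lastPos                      ∎
      by-cases : Dec (i ≡ lastPos) → piLast (2 + n) (act σ τ α) i ≡ act σ τ β i
      by-cases (yes i≡last) = subst (λ k → piLast (2 + n) (act σ τ α) k ≡ act σ τ β k) (sym i≡last) at-lastPos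
      by-cases (no i≢last)  = trans (piLast-away (act σ τ α) i≢last) (sym (act-updateAt-away α (π (α j)) i≢last))
    B'≡ : ∀ α → B' α ≡ Mπ (2 + n) (act σ τ α)
    B'≡ α = begin
      B' α                                       ≡⟨ reflection α ⟩
      B (α [ j ]≔ π (α j))                       ≡⟨ B≡ (α [ j ]≔ π (α j)) ⟩
      M4 (2 + n) (act σ τ (α [ j ]≔ π (α j)))    ≡⟨ M4-cong (piLast-act α) ⟨
      Mπ (2 + n) (act σ τ α)                     ∎

pair-normal-form : ∀ {n} {f f' : Form (3 + n)} {B B' : Matrix (3 + n)} {P P' : BPParams (3 + n)} →
  Represents f B → Represents f' B' → IsBlockPerm B P → IsBlockPerm B' P' →
  NoNewEntries B P B' → NoNewEntries B' P' B →
  ∀ j → eps P j ≢ eps P' j → (∀ i → i ≢ j → eps P i ≡ eps P' i) →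
  Σ (Permutation′ (3 + n)) λ σ → Σ (Fin (3 + n) → Permutation′ 4) λ τ →
    ∀ α → B α ≡ M4 (3 + n) (act σ τ α) × B' α ≡ Mπ (3 + n) (act σ τ α)
pair-normal-form {f = f} {f'} {P = P} {P'} rep rep' isBP isBP' nne nne' j differ agree =
  σ , τ , normal-form (PC.transpose m₁ m₂) rep
            (Reflection.reflection {f = f} {f'} {P = P} {P'} rep rep' isBP isBP' nne nne' j agree C)
            (swap01-conjugate (f j) m₂≡m₁+1)
  where
  oriented : Σ (Crossing (eps P j) (eps P' j) (s P xor s P')) λ C →
             f j ⟨$⟩ʳ Crossing.m₂ C ≡ (f j ⟨$⟩ʳ Crossing.m₁ C) +₄ 1F
  oriented = orient-crossing (f j)
    (oddness {f = f} {P = P} rep isBP (punchInᵢ≢i j 0F ∘ sym) (punchInᵢ≢i j 1F) ((λ ()) ∘ punchIn-injective j 1F 0F))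
    (crossing _ _ differ _)
  C = proj₁ oriented
  m₂≡m₁+1 = proj₂ oriented
  open Crossing C
  open NormalForm f j (f j ⟨$⟩ʳ m₁)

proposition9 : (d : ℕ) → 3 ≤ d →
    (l : ℚ) → 0ℚ < l → l < 1ℚ →
    (B B' : Matrix d) → Equivalent (M4 d) B → Equivalent (M4 d) B' →
    (P P' : BPParams d) → IsBlockPerm B P → IsBlockPerm B' P' →
    TessIndexEq P P' (d ∸ 1) →
    NoNewEntries B P B' → NoNewEntries B' P' B →
    Σ (Matrix d) λ N → InL4 d N × Equivalent N (combo l B B')
proposition9 (suc (suc (suc n))) (s≤s (s≤s (s≤s _))) l 0<l l<1 B B' B~M4 B'~M4 P P' isBP isBP' tess nne nne' =
  let f , rep = represent B~M4
      f' , rep' = represent B'~M4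
      j , differ , agree = tessellation-single-difference {P = P} {P'} tess
      σ , τ , normal = pair-normal-form {f = f} {f'} {P = P} {P'} rep rep' isBP isBP' nne nne' j differ agree
  in (λ α → l ℚ.* M4 _ α ℚ.+ (1ℚ ℚ.- l) ℚ.* Mπ _ α) , (l , 0<l , l<1 , λ _ → refl) ,
     (σ , τ , λ α → cong₂ (λ b b' → l ℚ.* b ℚ.+ (1ℚ ℚ.- l) ℚ.* b') (proj₁ (normal α)) (proj₂ (normal α)))
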